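{- Let $n$ be a positive integer with $\omega(n)\ge 2$ which is bi-unitary $4$-perfect, i.e. $\sigma^{**}(n)=4n$. Then $n$ is a bi-unitary harmonic number.
   Context: $\omega(n)$ is the number of distinct prime factors of $n$. A divisor $d$ of $n$ is a unitary divisor if $\gcd(d,n/d)=1$; a divisor $d$ of $n$ is a bi-unitary divisor if the greatest common unitary divisor of $d$ and $n/d$ is $1$. $\sigma^{**}(n)$ denotes the sum and $d^{**}(n)$ the number of bi-unitary divisors of $n$. $n$ is bi-unitary harmonic if $\sigma^{**}(n)\mid n\,d^{**}(n)$. -}

module Defs where

open import Data.Nat using (ℕ; zero; suc; _/_; _⊔_; _≡ᵇ_; _*_)
open import Data.Nat.Divisibility using (_∣?_)
open import Data.Nat.GCD using (gcd)
open import Data.Nat.Primality using (prime?)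
open import Data.Bool using (Bool; _∧_)
open import Data.List using (List; applyUpTo; filterᵇ; length; foldr)
open import Data.Nat.ListAction using (sum)
open import Data.Nat.Divisibility using (_∣_)
open import Relation.Nullary.Decidable using (⌊_⌋)

range1 : ℕ → List ℕ
range1 n = applyUpTo suc n

-- cofactor n / d (only used for divisors d ≥ 1; value 0 for d = 0)
cofactor : ℕ → ℕ → ℕ
cofactor n zero    = 0
cofactor n (suc k) = n / suc k

isDivisor : ℕ → ℕ → Bool
isDivisor d n = ⌊ d ∣? n ⌋

isUnitaryDivisor : ℕ → ℕ → Bool
isUnitaryDivisor d n = isDivisor d n ∧ (gcd d (cofactor n d) ≡ᵇ 1)

gcud : ℕ → ℕ → ℕ
gcud a b = foldr _⊔_ 0 (filterᵇ (λ e → isUnitaryDivisor e a ∧ isUnitaryDivisor e b) (range1 a))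

isBiUnitaryDivisor : ℕ → ℕ → Bool
isBiUnitaryDivisor d n = isDivisor d n ∧ (gcud d (cofactor n d) ≡ᵇ 1)

biUnitaryDivisors : ℕ → List ℕ
biUnitaryDivisors n = filterᵇ (λ d → isBiUnitaryDivisor d n) (range1 n)

σ** : ℕ → ℕ
σ** n = sum (biUnitaryDivisors n)

d** : ℕ → ℕ
d** n = length (biUnitaryDivisors n)

ω : ℕ → ℕ
ω n = length (filterᵇ (λ p → ⌊ prime? p ⌋ ∧ isDivisor p n) (range1 n))

BiUnitaryHarmonic : ℕ → Set
BiUnitaryHarmonic n = σ** n ∣ n * d** n

module Submission where

-- Since σ**(n) = 4n, the condition σ**(n) ∣ n · d**(n) reduces to 4 ∣ d**(n).  Because
-- ω(n) ≥ 2, n = q · r where q = p ^ k is the full power of one prime divisor p; then q and r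
-- are coprime and both exceed 1.  Every divisor of q · r factors uniquely as a · b with a ∣ q
-- and b ∣ r, and a · b is bi-unitary in q · r iff a is bi-unitary in q and b is in r.  Hence
-- a · b ↦ (q / a) · b and a · b ↦ a · (r / b) are commuting involutions of the bi-unitary
-- divisors of n, and no non-identity combination of them has a fixed point, because a
-- bi-unitary divisor a of q > 1 never equals q / a.  This free action of the Klein four-group
-- splits the bi-unitary divisors into orbits of size four, so 4 ∣ d**(n).

open import Defs
open import Data.Nat using (ℕ; zero; suc; _+_; _*_; _^_; _/_; _⊔_; _≤_; _<_; _≡ᵇ_; z≤n; s≤s; z<s;
  NonZero; ≢-nonZero; nonTrivial⇒≢1; nonTrivial⇒n>1)
open import Data.Nat.Properties using (*-comm; *-identityʳ; *-identityˡ; *-zeroʳ;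
  *-commutativeSemigroup; m*n≡0⇒m≡0∨n≡0; m^n≢0; m≤m*n; m<m*n; m≤n+m; <-≤-trans; <⇒≢;
  m<n⇒n≢0; n>0⇒n≢0; n≢0⇒n>0; suc-injective; ≤-antisym; ≤-reflexive; ≡ᵇ⇒≡; ≡⇒≡ᵇ; ⊔-lub; m≤n⇒m≤n⊔o; m≤n⇒m≤o⊔n)
open import Data.Nat.Divisibility
open import Data.Nat.DivMod using (m*n/n≡m; m/n*n≡m; n/1≡n)
open import Data.Nat.GCD using (gcd; gcd[m,n]∣m; gcd[m,n]∣n; gcd-greatest; gcd[m,n]≢0)
open import Data.Nat.Coprimality as Coprimality
  using (Coprime; coprime-divisor; coprime-/gcd; coprime⇒gcd≡1; gcd≡1⇒coprime)
open import Data.Nat.Primality using (Prime; prime?; prime⇒irreducible; prime⇒nonZero; prime⇒nonTrivial)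
open import Data.Nat.Induction using (<-rec)
open import Data.Nat.Solver using (module +-*-Solver)
open +-*-Solver using (solve; _:*_; _:=_)
open import Algebra.Properties.CommutativeSemigroup *-commutativeSemigroup
  using () renaming (interchange to *-interchange)
open import Data.Bool using (Bool; true; false; T; not; _∧_; if_then_else_)
open import Data.Bool.Properties using (T-∧)
open import Data.Unit using (tt)
open import Data.List using (List; foldr; length; filterᵇ; applyUpTo)
open import Data.List.Properties using (foldr-preservesᵇ; foldr-preservesᵒ)
open import Data.List.Membership.Propositional using (_∈_)
open import Data.List.Membership.Propositional.Properties using (∈-filter⁺; ∈-filter⁻; ∈-applyUpTo⁺)
open import Data.List.Relation.Unary.All as All using (All)
open import Data.List.Relation.Unary.Any as Any using ()
open import Data.Product using (Σ-syntax; _×_; _,_; proj₁; proj₂)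
open import Data.Sum using (_⊎_; inj₁; inj₂; [_,_])
open import Function using (_∘_; case_of_)
open import Function.Bundles using (Equivalence)
open import Relation.Nullary using (¬_; yes; no; contradiction)
open import Relation.Nullary.Decidable using (⌊_⌋; T?; toWitness; fromWitness)
open import Relation.Binary.PropositionalEquality hiding ([_])

count : (ℕ → Bool) → ℕ → ℕ
count Q zero    = 0
count Q (suc N) = if Q 0 then suc (count (Q ∘ suc) N) else count (Q ∘ suc) N

length-filter-applyUpTo : ∀ (P : ℕ → Bool) h N →
  length (filterᵇ P (applyUpTo h N)) ≡ count (P ∘ h) N
length-filter-applyUpTo P h zero = refl
length-filter-applyUpTo P h (suc N) with P (h 0)
... | true  = cong suc (length-filter-applyUpTo P (h ∘ suc) N)
... | false = length-filter-applyUpTo P (h ∘ suc) N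

count-skip-0 : ∀ Q N → ¬ T (Q 0) → count Q (suc N) ≡ count (Q ∘ suc) N
count-skip-0 Q N ¬q0 with Q 0
... | true  = contradiction tt ¬q0
... | false = refl

_─_ : (ℕ → Bool) → ℕ → ℕ → Bool
(Q ─ a) x = not (x ≡ᵇ a) ∧ Q x

infixl 5 _─_

─-intro : ∀ {Q a x} → x ≢ a → T (Q x) → T ((Q ─ a) x)
─-intro {a = a} {x} x≢a qx with x ≡ᵇ a in eq
... | true  = contradiction (≡ᵇ⇒≡ x a (subst T (sym eq) tt)) x≢a
... | false = qx

─-elim : ∀ {Q a x} → T ((Q ─ a) x) → x ≢ a × T (Q x)
─-elim {a = a} {x} h with x ≡ᵇ a in eq
... | false = (λ x≡a → subst T eq (≡⇒≡ᵇ x a x≡a)) , h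

count-remove : ∀ Q {N a} → a < N → T (Q a) → count Q N ≡ suc (count (Q ─ a) N)
count-remove Q {suc N} {zero} _ qa with Q 0
... | true = refl
count-remove Q {suc N} {suc a} (s≤s a<N) qa with Q 0
... | true  = cong suc (count-remove (Q ∘ suc) a<N qa)
... | false = count-remove (Q ∘ suc) a<N qa

count-zero-or-witness : ∀ Q N → count Q N ≡ 0 ⊎ Σ[ a ∈ ℕ ] a < N × T (Q a)
count-zero-or-witness Q zero = inj₁ refl
count-zero-or-witness Q (suc N) with Q 0 in q0 | count-zero-or-witness (Q ∘ suc) N
... | true  | _                  = inj₂ (0 , z<s , subst T (sym q0) tt)
... | false | inj₁ none          = inj₁ none
... | false | inj₂ (a , a<N , qa) = inj₂ (suc a , s≤s a<N , qa)

two-witnesses : ∀ Q N → 2 ≤ count Q N → Σ[ a ∈ ℕ ] Σ[ b ∈ ℕ ] T (Q a) × T (Q b) × a ≢ b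
two-witnesses Q N 2≤count with count-zero-or-witness Q N
... | inj₁ none = contradiction (subst (2 ≤_) none 2≤count) λ ()
... | inj₂ (a , a<N , qa) with count-zero-or-witness (Q ─ a) N
...   | inj₁ none = contradiction (subst (2 ≤_) (trans (count-remove Q a<N qa) (cong suc none)) 2≤count)
                      λ { (s≤s ()) }
...   | inj₂ (b , _ , q'b) with ─-elim {Q} q'b
...     | b≢a , qb = b , a , qb , qa , b≢a

record FreeKleinAction (Q : ℕ → Bool) (f g : ℕ → ℕ) : Set where
  field
    f-closed     : ∀ {x} → T (Q x) → T (Q (f x))
    g-closed     : ∀ {x} → T (Q x) → T (Q (g x))
    f-involutive : ∀ {x} → T (Q x) → f (f x) ≡ x
    g-involutive : ∀ {x} → T (Q x) → g (g x) ≡ x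
    commute      : ∀ {x} → T (Q x) → f (g x) ≡ g (f x)
    f-free       : ∀ {x} → T (Q x) → f x ≢ x
    g-free       : ∀ {x} → T (Q x) → g x ≢ x
    fg-free      : ∀ {x} → T (Q x) → f (g x) ≢ x

module RemoveOrbit {Q f g} (K : FreeKleinAction Q f g) {a} (qa : T (Q a)) where
  open FreeKleinAction K

  rest : ℕ → Bool
  rest = Q ─ a ─ f a ─ g a ─ f (g a)

  InOrbit : ℕ → Set
  InOrbit x = x ≡ a ⊎ x ≡ f a ⊎ x ≡ g a ⊎ x ≡ f (g a)

  private
    qfa : T (Q (f a))
    qfa = f-closed qa
    qga : T (Q (g a))
    qga = g-closed qa
    qfga : T (Q (f (g a)))
    qfga = f-closed qga

  rest-elim : ∀ {x} → T (rest x) → T (Q x) × ¬ InOrbit x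
  rest-elim r with ─-elim {Q ─ a ─ f a ─ g a} r
  ... | x≢fga , r₃ with ─-elim {Q ─ a ─ f a} r₃
  ... | x≢ga , r₂ with ─-elim {Q ─ a} r₂
  ... | x≢fa , r₁ with ─-elim {Q} r₁
  ... | x≢a , qx = qx , λ { (inj₁ e) → x≢a e ; (inj₂ (inj₁ e)) → x≢fa e
                          ; (inj₂ (inj₂ (inj₁ e))) → x≢ga e ; (inj₂ (inj₂ (inj₂ e))) → x≢fga e }

  rest-intro : ∀ {x} → T (Q x) → ¬ InOrbit x → T (rest x)
  rest-intro qx out =
    ─-intro {Q ─ a ─ f a ─ g a} (out ∘ inj₂ ∘ inj₂ ∘ inj₂)
      (─-intro {Q ─ a ─ f a} (out ∘ inj₂ ∘ inj₂ ∘ inj₁)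
        (─-intro {Q ─ a} (out ∘ inj₂ ∘ inj₁)
          (─-intro {Q} (out ∘ inj₁) qx)))

  f-orbit : ∀ {x} → T (Q x) → InOrbit (f x) → InOrbit x
  f-orbit {x} qx = λ
    { (inj₁ e)                 → inj₂ (inj₁ (back e))
    ; (inj₂ (inj₁ e))          → inj₁ (trans (back e) (f-involutive qa))
    ; (inj₂ (inj₂ (inj₁ e)))   → inj₂ (inj₂ (inj₂ (back e)))
    ; (inj₂ (inj₂ (inj₂ e)))   → inj₂ (inj₂ (inj₁ (trans (back e) (f-involutive qga)))) }
    where
    back : ∀ {y} → f x ≡ y → x ≡ f y
    back e = trans (sym (f-involutive qx)) (cong f e)

  g-orbit : ∀ {x} → T (Q x) → InOrbit (g x) → InOrbit x
  g-orbit {x} qx = λ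
    { (inj₁ e)                 → inj₂ (inj₂ (inj₁ (back e)))
    ; (inj₂ (inj₁ e))          → inj₂ (inj₂ (inj₂ (trans (back e) (sym (commute qa)))))
    ; (inj₂ (inj₂ (inj₁ e)))   → inj₁ (trans (back e) (g-involutive qa))
    ; (inj₂ (inj₂ (inj₂ e)))   →
        inj₂ (inj₁ (trans (back e) (trans (cong g (commute qa)) (g-involutive qfa)))) }
    where
    back : ∀ {y} → g x ≡ y → x ≡ g y
    back e = trans (sym (g-involutive qx)) (cong g e)

  rest-action : FreeKleinAction rest f g
  rest-action = record
    { f-closed     = λ r → let qx , out = rest-elim r in rest-intro (f-closed qx) (out ∘ f-orbit qx)
    ; g-closed     = λ r → let qx , out = rest-elim r in rest-intro (g-closed qx) (out ∘ g-orbit qx)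
    ; f-involutive = f-involutive ∘ in-Q
    ; g-involutive = g-involutive ∘ in-Q
    ; commute      = commute ∘ in-Q
    ; f-free       = f-free ∘ in-Q
    ; g-free       = g-free ∘ in-Q
    ; fg-free      = fg-free ∘ in-Q
    }
    where
    in-Q : ∀ {x} → T (rest x) → T (Q x)
    in-Q r = proj₁ (rest-elim r)

  count-rest : ∀ {N} → (∀ {x} → T (Q x) → x < N) → count Q N ≡ 4 + count rest N
  count-rest {N} bound = begin
    count Q N                        ≡⟨ count-remove Q (bound qa) qa ⟩
    1 + count (Q ─ a) N              ≡⟨ cong (1 +_) (count-remove (Q ─ a) (bound qfa) fa-left) ⟩
    2 + count (Q ─ a ─ f a) N        ≡⟨ cong (2 +_) (count-remove (Q ─ a ─ f a) (bound qga) ga-left) ⟩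
    3 + count (Q ─ a ─ f a ─ g a) N  ≡⟨ cong (3 +_) (count-remove (Q ─ a ─ f a ─ g a)
                                                       (bound qfga) fga-left) ⟩
    4 + count rest N                 ∎
    where
    open ≡-Reasoning
    fa≢a : f a ≢ a
    fa≢a = f-free qa
    ga≢a : g a ≢ a
    ga≢a = g-free qa
    ga≢fa : g a ≢ f a
    ga≢fa e = fg-free qa (trans (cong f e) (f-involutive qa))
    fga≢fa : f (g a) ≢ f a
    fga≢fa e = g-free qa (trans (sym (f-involutive qga)) (trans (cong f e) (f-involutive qa)))
    fga≢ga : f (g a) ≢ g a
    fga≢ga = f-free qga
    fa-left : T ((Q ─ a) (f a))
    fa-left = ─-intro {Q} fa≢a qfa
    ga-left : T ((Q ─ a ─ f a) (g a))
    ga-left = ─-intro {Q ─ a} ga≢fa (─-intro {Q} ga≢a qga)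
    fga-left : T ((Q ─ a ─ f a ─ g a) (f (g a)))
    fga-left = ─-intro {Q ─ a ─ f a} fga≢ga (─-intro {Q ─ a} fga≢fa (─-intro {Q} (fg-free qa) qfga))

-- The number of points of a bounded predicate carrying a free Klein action is divisible by 4:
-- by strong induction on the count, removing one orbit at a time.
four-∣-count : ∀ {Q f g N} → FreeKleinAction Q f g → (∀ {x} → T (Q x) → x < N) → 4 ∣ count Q N
four-∣-count {Q} {f} {g} {N} K bound = <-rec Motive step (count Q N) K bound refl
  where
  Motive : ℕ → Set
  Motive c = ∀ {Q} → FreeKleinAction Q f g → (∀ {x} → T (Q x) → x < N) → count Q N ≡ c → 4 ∣ c
  step : ∀ c → (∀ {c'} → c' < c → Motive c') → Motive c
  step c rec {Q} K bound refl with count-zero-or-witness Q N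
  ... | inj₁ none = subst (4 ∣_) (sym none) (4 ∣0)
  ... | inj₂ (a , _ , qa) = subst (4 ∣_) (sym removed) (∣m∣n⇒∣m+n ∣-refl 4∣rest)
    where
    open RemoveOrbit K qa
    removed : count Q N ≡ 4 + count rest N
    removed = count-rest bound
    4∣rest : 4 ∣ count rest N
    4∣rest = rec (subst (count rest N <_) (sym removed) (s≤s (m≤n+m _ 3)))
                 rest-action (bound ∘ proj₁ ∘ rest-elim) refl

coprime-∣ : ∀ {m n d e} → Coprime m n → d ∣ m → e ∣ n → Coprime d e
coprime-∣ m⊥n d∣m e∣n (i∣d , i∣e) = m⊥n (∣-trans i∣d d∣m , ∣-trans i∣e e∣n)

coprime-* : ∀ {a b n} → Coprime a n → Coprime b n → Coprime (a * b) n
coprime-* {a} a⊥n b⊥n {d} (d∣ab , d∣n) = b⊥n (coprime-divisor d⊥a d∣ab , d∣n)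
  where
  d⊥a : Coprime d a
  d⊥a (e∣d , e∣a) = a⊥n (e∣a , ∣-trans e∣d d∣n)

coprime-∣-* : ∀ {a b m} → Coprime a b → a ∣ m → b ∣ m → a * b ∣ m
coprime-∣-* {a} {b} a⊥b (divides k refl) b∣ka
  with coprime-divisor (Coprimality.sym a⊥b) (subst (b ∣_) (*-comm k a) b∣ka)
... | divides j refl = divides j (solve 3 (λ j b a → (j :* b) :* a := j :* (a :* b)) refl j b a)

divisor-≢0 : ∀ {a q} → q ≢ 0 → a ∣ q → a ≢ 0
divisor-≢0 q≢0 a∣q refl = q≢0 (0∣⇒≡0 a∣q)

*-≢0 : ∀ {a b} → a ≢ 0 → b ≢ 0 → a * b ≢ 0
*-≢0 {a} a≢0 b≢0 ab≡0 = [ a≢0 , b≢0 ] (m*n≡0⇒m≡0∨n≡0 a ab≡0)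

cofactor-spec : ∀ {a q} → a ∣ q → q ≡ a * cofactor q a
cofactor-spec {zero}  a∣q = 0∣⇒≡0 a∣q
cofactor-spec {suc k} a∣q = sym (trans (*-comm (suc k) _) (m/n*n≡m a∣q))

cofactor-* : ∀ a b → a ≢ 0 → cofactor (a * b) a ≡ b
cofactor-* zero    b a≢0 = contradiction refl a≢0
cofactor-* (suc k) b _   = trans (cong (_/ suc k) (*-comm (suc k) b)) (m*n/n≡m b (suc k))

cofactor-1 : ∀ q → cofactor q 1 ≡ q
cofactor-1 = n/1≡n

cofactor-∣ : ∀ {a q} → a ∣ q → cofactor q a ∣ q
cofactor-∣ {a} a∣q = divides a (cofactor-spec a∣q)

cofactor-involutive : ∀ {a q} → q ≢ 0 → a ∣ q → cofactor q (cofactor q a) ≡ a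
cofactor-involutive {a} {q} q≢0 a∣q = begin
  cofactor q a'               ≡⟨ cong (λ m → cofactor m a') (trans (cofactor-spec a∣q) (*-comm a a')) ⟩
  cofactor (a' * a) a'        ≡⟨ cofactor-* a' a (divisor-≢0 q≢0 (cofactor-∣ a∣q)) ⟩
  a                           ∎
  where
  open ≡-Reasoning
  a' : ℕ
  a' = cofactor q a

Unitary : ℕ → ℕ → Set
Unitary u x = Σ[ v ∈ ℕ ] x ≡ u * v × Coprime u v

unitary-∣ : ∀ {u x} → Unitary u x → u ∣ x
unitary-∣ {u} (v , refl , _) = divides v (*-comm u v)

unitary-refl : ∀ x → Unitary x x
unitary-refl x = 1 , sym (*-identityʳ x) , λ (_ , d∣1) → ∣1⇒≡1 d∣1

unitary-one : ∀ x → Unitary 1 x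
unitary-one x = x , sym (*-identityˡ x) , Coprimality.1-coprimeTo x

NoCommonUnitary : ℕ → ℕ → Set
NoCommonUnitary x y = ∀ u → Unitary u x → Unitary u y → u ≡ 1

ncu-sym : ∀ {x y} → NoCommonUnitary x y → NoCommonUnitary y x
ncu-sym ncu u u∥y u∥x = ncu u u∥x u∥y

BiUnitary : ℕ → ℕ → Set
BiUnitary d n = d ∣ n × NoCommonUnitary d (cofactor n d)

biunitary-complement : ∀ {d n} → n ≢ 0 → BiUnitary d n → BiUnitary (cofactor n d) n
biunitary-complement n≢0 (d∣n , ncu) =
  cofactor-∣ d∣n , subst (NoCommonUnitary _) (sym (cofactor-involutive n≢0 d∣n)) (ncu-sym ncu)

-- ... and differs from it when n > 1: d = n / d would be a common unitary divisor of d and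
-- n / d, forcing d = 1 and then n = 1.
biunitary-complement-≢ : ∀ {d n} → 1 < n → BiUnitary d n → cofactor n d ≢ d
biunitary-complement-≢ {d} {n} 1<n (_ , ncu) d'≡d = <⇒≢ 1<n (sym n≡1)
  where
  d≡1 : d ≡ 1
  d≡1 = ncu d (unitary-refl d) (subst (Unitary d) (sym d'≡d) (unitary-refl d))
  n≡1 : n ≡ 1
  n≡1 = begin
    n            ≡⟨ sym (cofactor-1 n) ⟩
    cofactor n 1 ≡⟨ cong (cofactor n) (sym d≡1) ⟩
    cofactor n d ≡⟨ d'≡d ⟩
    d            ≡⟨ d≡1 ⟩
    1            ∎
    where open ≡-Reasoning

gcd-coprime-part : ∀ {q r a b} → Coprime q r → a ∣ q → b ∣ r → gcd (a * b) q ≡ a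
gcd-coprime-part {q} {r} {a} {b} q⊥r a∣q b∣r = ∣-antisym G∣a (gcd-greatest (m∣m*n b) a∣q)
  where
  G : ℕ
  G = gcd (a * b) q
  G∣a : G ∣ a
  G∣a = coprime-divisor (coprime-∣ q⊥r (gcd[m,n]∣n (a * b) q) b∣r)
          (subst (G ∣_) (*-comm a b) (gcd[m,n]∣m (a * b) q))

module CoprimeFactorization {q r : ℕ} (q⊥r : Coprime q r) (q≢0 : q ≢ 0) (r≢0 : r ≢ 0) where

  gcd-r-part : ∀ {a b} → a ∣ q → b ∣ r → gcd (a * b) r ≡ b
  gcd-r-part {a} {b} a∣q b∣r =
    trans (cong (λ m → gcd m r) (*-comm a b)) (gcd-coprime-part (Coprimality.sym q⊥r) b∣r a∣q)

  factors-unique : ∀ {a b a' b'} → a ∣ q → b ∣ r → a' ∣ q → b' ∣ r →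
    a * b ≡ a' * b' → a ≡ a' × b ≡ b'
  factors-unique a∣q b∣r a'∣q b'∣r e =
    trans (sym (gcd-coprime-part q⊥r a∣q b∣r))
      (trans (cong (λ m → gcd m q) e) (gcd-coprime-part q⊥r a'∣q b'∣r)) ,
    trans (sym (gcd-r-part a∣q b∣r)) (trans (cong (λ m → gcd m r) e) (gcd-r-part a'∣q b'∣r))

  Factorization : ℕ → Set
  Factorization d = Σ[ a ∈ ℕ ] Σ[ b ∈ ℕ ] a ∣ q × b ∣ r × d ≡ a * b

  -- Every divisor of q * r has a factorization: take a = gcd d q.
  factorize : ∀ {d} → d ∣ q * r → Factorization d
  factorize {d} d∣qr = g , d / g , gcd[m,n]∣n d q , d/g∣r , d≡g*d/g
    where
    g : ℕ
    g = gcd d q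
    instance
      g≢0 : NonZero g
      g≢0 = ≢-nonZero (gcd[m,n]≢0 d q (inj₂ q≢0))
    d≡g*d/g : d ≡ g * (d / g)
    d≡g*d/g = sym (trans (*-comm g (d / g)) (m/n*n≡m (gcd[m,n]∣m d q)))
    qr≡g*[q/g*r] : q * r ≡ g * (q / g * r)
    qr≡g*[q/g*r] = begin
      q * r             ≡⟨ cong (_* r) (sym (m/n*n≡m (gcd[m,n]∣n d q))) ⟩
      q / g * g * r     ≡⟨ solve 3 (λ x g r → x :* g :* r := g :* (x :* r)) refl (q / g) g r ⟩
      g * (q / g * r)   ∎
      where open ≡-Reasoning
    d/g∣r : d / g ∣ r
    d/g∣r = coprime-divisor (coprime-/gcd d q) (*-cancelˡ-∣ g (subst₂ _∣_ d≡g*d/g qr≡g*[q/g*r] d∣qr))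

  private
    unitary-parts-∣ : ∀ {u x m} → x ∣ m → (p : Unitary u x) → u ∣ m × proj₁ p ∣ m
    unitary-parts-∣ {u} x∣m (v , x≡uv , u⊥v) =
      ∣-trans (unitary-∣ (v , x≡uv , u⊥v)) x∣m , ∣-trans (divides u x≡uv) x∣m

  unitary-combine : ∀ {x₁ x₂ u₁ u₂} → x₁ ∣ q → x₂ ∣ r →
    Unitary u₁ x₁ → Unitary u₂ x₂ → Unitary (u₁ * u₂) (x₁ * x₂)
  unitary-combine {u₁ = u₁} {u₂} x₁∣q x₂∣r p₁@(v₁ , e₁ , u₁⊥v₁) p₂@(v₂ , e₂ , u₂⊥v₂) =
    v₁ * v₂ , trans (cong₂ _*_ e₁ e₂) (*-interchange u₁ v₁ u₂ v₂) ,
    coprime-* (Coprimality.sym (coprime-* (Coprimality.sym u₁⊥v₁) (coprime-∣ r⊥q v₂∣r u₁∣q)))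
              (Coprimality.sym (coprime-* (coprime-∣ q⊥r v₁∣q u₂∣r) (Coprimality.sym u₂⊥v₂)))
    where
    r⊥q : Coprime r q
    r⊥q = Coprimality.sym q⊥r
    u₁∣q : u₁ ∣ q
    u₁∣q = proj₁ (unitary-parts-∣ x₁∣q p₁)
    v₁∣q : v₁ ∣ q
    v₁∣q = proj₂ (unitary-parts-∣ x₁∣q p₁)
    u₂∣r : u₂ ∣ r
    u₂∣r = proj₁ (unitary-parts-∣ x₂∣r p₂)
    v₂∣r : v₂ ∣ r
    v₂∣r = proj₂ (unitary-parts-∣ x₂∣r p₂)

  UnitarySplitting : ℕ → ℕ → ℕ → Set
  UnitarySplitting u x₁ x₂ = Σ[ u₁ ∈ ℕ ] Σ[ u₂ ∈ ℕ ] u ≡ u₁ * u₂ × Unitary u₁ x₁ × Unitary u₂ x₂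

  unitary-split : ∀ {x₁ x₂ u} → x₁ ∣ q → x₂ ∣ r → Unitary u (x₁ * x₂) → UnitarySplitting u x₁ x₂
  unitary-split {x₁} {x₂} {u} x₁∣q x₂∣r (v , e , u⊥v) =
    combine (factorize (∣-trans (divides v (trans e (*-comm u v))) x₁x₂∣qr))
            (factorize (∣-trans (divides u e) x₁x₂∣qr))
    where
    x₁x₂∣qr : x₁ * x₂ ∣ q * r
    x₁x₂∣qr = *-pres-∣ x₁∣q x₂∣r
    -- factor u = u₁ * u₂ and v = v₁ * v₂; then x₁ = u₁ * v₁ and x₂ = u₂ * v₂ by uniqueness
    combine : Factorization u → Factorization v → UnitarySplitting u x₁ x₂
    combine (u₁ , u₂ , u₁∣q , u₂∣r , u≡) (v₁ , v₂ , v₁∣q , v₂∣r , v≡) =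
      u₁ , u₂ , u≡ , (v₁ , proj₁ parts , u₁⊥v₁) , (v₂ , proj₂ parts , u₂⊥v₂)
      where
      u₁⊥v₁ : Coprime u₁ v₁
      u₁⊥v₁ = coprime-∣ u⊥v (divides u₂ (trans u≡ (*-comm u₁ u₂)))
                            (divides v₂ (trans v≡ (*-comm v₁ v₂)))
      u₂⊥v₂ : Coprime u₂ v₂
      u₂⊥v₂ = coprime-∣ u⊥v (divides u₁ u≡) (divides v₁ v≡)
      x₁x₂≡ : x₁ * x₂ ≡ (u₁ * v₁) * (u₂ * v₂)
      x₁x₂≡ = trans e (trans (cong₂ _*_ u≡ v≡) (*-interchange u₁ u₂ v₁ v₂))
      parts : x₁ ≡ u₁ * v₁ × x₂ ≡ u₂ * v₂
      parts = factors-unique x₁∣q x₂∣r (coprime-∣-* u₁⊥v₁ u₁∣q v₁∣q)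
                                       (coprime-∣-* u₂⊥v₂ u₂∣r v₂∣r) x₁x₂≡

  ncu-combine : ∀ {x₁ x₂ y₁ y₂} → x₁ ∣ q → x₂ ∣ r → y₁ ∣ q → y₂ ∣ r →
    NoCommonUnitary x₁ y₁ → NoCommonUnitary x₂ y₂ → NoCommonUnitary (x₁ * x₂) (y₁ * y₂)
  ncu-combine {x₁} {x₂} {y₁} {y₂} x₁∣q x₂∣r y₁∣q y₂∣r ncu₁ ncu₂ u u∥x u∥y =
    trivial (unitary-split x₁∣q x₂∣r u∥x) (unitary-split y₁∣q y₂∣r u∥y)
    where
    -- both splittings of u agree, so each factor is a common unitary divisor of a part
    trivial : UnitarySplitting u x₁ x₂ → UnitarySplitting u y₁ y₂ → u ≡ 1
    trivial (u₁ , u₂ , u≡ , u₁∥x₁ , u₂∥x₂) (w₁ , w₂ , u≡' , w₁∥y₁ , w₂∥y₂) =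
      trans u≡ (cong₂ _*_ (ncu₁ u₁ u₁∥x₁ (subst (λ z → Unitary z y₁) (sym (proj₁ same)) w₁∥y₁))
                          (ncu₂ u₂ u₂∥x₂ (subst (λ z → Unitary z y₂) (sym (proj₂ same)) w₂∥y₂)))
      where
      same : u₁ ≡ w₁ × u₂ ≡ w₂
      same = factors-unique (∣-trans (unitary-∣ u₁∥x₁) x₁∣q) (∣-trans (unitary-∣ u₂∥x₂) x₂∣r)
               (∣-trans (unitary-∣ w₁∥y₁) y₁∣q) (∣-trans (unitary-∣ w₂∥y₂) y₂∣r) (trans (sym u≡) u≡')

  -- Conversely, extending a common unitary divisor of x₁ and y₁ by the unitary divisor 1 of the
  -- second parts gives one of the products; similarly for the second parts.
  ncu-split : ∀ {x₁ x₂ y₁ y₂} → x₁ ∣ q → x₂ ∣ r → y₁ ∣ q → y₂ ∣ r →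
    NoCommonUnitary (x₁ * x₂) (y₁ * y₂) → NoCommonUnitary x₁ y₁ × NoCommonUnitary x₂ y₂
  ncu-split {x₁} {x₂} {y₁} {y₂} x₁∣q x₂∣r y₁∣q y₂∣r ncu =
    (λ u u∥x₁ u∥y₁ → trans (sym (*-identityʳ u))
      (ncu (u * 1) (unitary-combine x₁∣q x₂∣r u∥x₁ (unitary-one x₂))
                   (unitary-combine y₁∣q y₂∣r u∥y₁ (unitary-one y₂)))) ,
    (λ u u∥x₂ u∥y₂ → trans (sym (*-identityˡ u))
      (ncu (1 * u) (unitary-combine x₁∣q x₂∣r (unitary-one x₁) u∥x₂)
                   (unitary-combine y₁∣q y₂∣r (unitary-one y₁) u∥y₂)))

  cofactor-split : ∀ {a b} → a ∣ q → b ∣ r → cofactor (q * r) (a * b) ≡ cofactor q a * cofactor r b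
  cofactor-split {a} {b} a∣q b∣r = begin
    cofactor (q * r) (a * b)                           ≡⟨ cong (λ m → cofactor m (a * b)) qr≡ ⟩
    cofactor ((a * b) * (cofactor q a * cofactor r b)) (a * b)
                                                       ≡⟨ cofactor-* (a * b) _ ab≢0 ⟩
    cofactor q a * cofactor r b                        ∎
    where
    open ≡-Reasoning
    qr≡ : q * r ≡ (a * b) * (cofactor q a * cofactor r b)
    qr≡ = trans (cong₂ _*_ (cofactor-spec a∣q) (cofactor-spec b∣r))
                (*-interchange a (cofactor q a) b (cofactor r b))
    ab≢0 : a * b ≢ 0
    ab≢0 = *-≢0 (divisor-≢0 q≢0 a∣q) (divisor-≢0 r≢0 b∣r)

  biunitary-combine : ∀ {a b} → BiUnitary a q → BiUnitary b r → BiUnitary (a * b) (q * r)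
  biunitary-combine (a∣q , ncu₁) (b∣r , ncu₂) =
    *-pres-∣ a∣q b∣r ,
    subst (NoCommonUnitary _) (sym (cofactor-split a∣q b∣r))
      (ncu-combine a∣q b∣r (cofactor-∣ a∣q) (cofactor-∣ b∣r) ncu₁ ncu₂)

  biunitary-split : ∀ {a b} → a ∣ q → b ∣ r → BiUnitary (a * b) (q * r) → BiUnitary a q × BiUnitary b r
  biunitary-split a∣q b∣r (_ , ncu)
    with ncu-split a∣q b∣r (cofactor-∣ a∣q) (cofactor-∣ b∣r)
           (subst (NoCommonUnitary _) (cofactor-split a∣q b∣r) ncu)
  ... | ncu₁ , ncu₂ = (a∣q , ncu₁) , (b∣r , ncu₂)

private
  ∧-intro : ∀ {x y} → T x → T y → T (x ∧ y)
  ∧-intro tx ty = Equivalence.from T-∧ (tx , ty)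

  ∧-elim : ∀ {x y} → T (x ∧ y) → T x × T y
  ∧-elim = Equivalence.to T-∧

maximum : List ℕ → ℕ
maximum = foldr _⊔_ 0

≤-maximum : ∀ {x xs} → x ∈ xs → x ≤ maximum xs
≤-maximum {xs = xs} x∈xs =
  foldr-preservesᵒ (λ y z → [ m≤n⇒m≤n⊔o z , m≤n⇒m≤o⊔n y ]) 0 xs (inj₂ (Any.map ≤-reflexive x∈xs))

maximum-≤ : ∀ {k xs} → All (_≤ k) xs → maximum xs ≤ k
maximum-≤ = foldr-preservesᵇ ⊔-lub z≤n

isUnitaryDivisor-sound : ∀ {u x} → T (isUnitaryDivisor u x) → Unitary u x
isUnitaryDivisor-sound {u} {x} t with ∧-elim {isDivisor u x} t
... | u∣x , gcd≡1 =
  cofactor x u , cofactor-spec (toWitness u∣x) , gcd≡1⇒coprime (≡ᵇ⇒≡ (gcd u (cofactor x u)) 1 gcd≡1)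

isUnitaryDivisor-complete : ∀ {u x} → u ≢ 0 → Unitary u x → T (isUnitaryDivisor u x)
isUnitaryDivisor-complete {u} u≢0 u∥x@(v , refl , u⊥v) =
  ∧-intro (fromWitness (unitary-∣ u∥x))
          (≡⇒≡ᵇ (gcd u (cofactor (u * v) u)) 1
            (trans (cong (gcd u) (cofactor-* u v u≢0)) (coprime⇒gcd≡1 u⊥v)))

∈-range1 : ∀ {u a} → u ≢ 0 → u ≤ a → u ∈ range1 a
∈-range1 {zero}  u≢0 _   = contradiction refl u≢0
∈-range1 {suc k} _   k<a = ∈-applyUpTo⁺ suc k<a

commonUnitary : ℕ → ℕ → ℕ → Bool
commonUnitary a b e = isUnitaryDivisor e a ∧ isUnitaryDivisor e b

commonUnitaries : ℕ → ℕ → List ℕ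
commonUnitaries a b = filterᵇ (commonUnitary a b) (range1 a)

gcud≡1⇒ncu : ∀ {a b} → a ≢ 0 → gcud a b ≡ 1 → NoCommonUnitary a b
gcud≡1⇒ncu {a} {b} a≢0 gcud≡1 u u∥a u∥b = ≤-antisym u≤1 (n≢0⇒n>0 u≢0)
  where
  u≢0 : u ≢ 0
  u≢0 = divisor-≢0 a≢0 (unitary-∣ u∥a)
  u∈ : u ∈ commonUnitaries a b
  u∈ = ∈-filter⁺ (T? ∘ commonUnitary a b) (∈-range1 u≢0 (∣⇒≤ {{≢-nonZero a≢0}} (unitary-∣ u∥a)))
         (∧-intro (isUnitaryDivisor-complete u≢0 u∥a) (isUnitaryDivisor-complete u≢0 u∥b))
  u≤1 : u ≤ 1
  u≤1 = subst (u ≤_) gcud≡1 (≤-maximum u∈)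

ncu⇒gcud≡1 : ∀ {a b} → a ≢ 0 → NoCommonUnitary a b → gcud a b ≡ 1
ncu⇒gcud≡1 {a} {b} a≢0 ncu = ≤-antisym (maximum-≤ (All.tabulate all≤1)) (≤-maximum 1∈)
  where
  all≤1 : ∀ {e} → e ∈ commonUnitaries a b → e ≤ 1
  all≤1 {e} e∈ with ∧-elim {isUnitaryDivisor e a}
                     (proj₂ (∈-filter⁻ (T? ∘ commonUnitary a b) {xs = range1 a} e∈))
  ... | e∥a , e∥b = ≤-reflexive (ncu e (isUnitaryDivisor-sound e∥a) (isUnitaryDivisor-sound e∥b))
  1∈ : 1 ∈ commonUnitaries a b
  1∈ = ∈-filter⁺ (T? ∘ commonUnitary a b) (∈-range1 (λ ()) (n≢0⇒n>0 a≢0))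
         (∧-intro (isUnitaryDivisor-complete (λ ()) (unitary-one a))
                  (isUnitaryDivisor-complete (λ ()) (unitary-one b)))

isBiUnitaryDivisor-sound : ∀ {d n} → n ≢ 0 → T (isBiUnitaryDivisor d n) → BiUnitary d n
isBiUnitaryDivisor-sound {d} {n} n≢0 t with ∧-elim {isDivisor d n} t
... | d∣n , gcud≡1 =
  toWitness d∣n , gcud≡1⇒ncu (divisor-≢0 n≢0 (toWitness d∣n)) (≡ᵇ⇒≡ (gcud d (cofactor n d)) 1 gcud≡1)

isBiUnitaryDivisor-complete : ∀ {d n} → n ≢ 0 → BiUnitary d n → T (isBiUnitaryDivisor d n)
isBiUnitaryDivisor-complete {d} {n} n≢0 (d∣n , ncu) =
  ∧-intro (fromWitness d∣n) (≡⇒≡ᵇ (gcud d (cofactor n d)) 1 (ncu⇒gcud≡1 (divisor-≢0 n≢0 d∣n) ncu))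

-- d**(n) counts the bi-unitary divisors among 0, 1, …, n (0 is never one when n ≠ 0).
d**-count : ∀ {n} → n ≢ 0 → d** n ≡ count (λ d → isBiUnitaryDivisor d n) (suc n)
d**-count {n} n≢0 = trans (length-filter-applyUpTo B suc n)
  (sym (count-skip-0 B n (λ bu → n≢0 (0∣⇒≡0 (proj₁ (isBiUnitaryDivisor-sound {0} n≢0 bu))))))
  where
  B : ℕ → Bool
  B d = isBiUnitaryDivisor d n

prime>1 : ∀ {p} → Prime p → 1 < p
prime>1 {p} P = nonTrivial⇒n>1 p {{prime⇒nonTrivial P}}

prime-∤⇒coprime : ∀ {p m} → Prime p → ¬ p ∣ m → Coprime p m
prime-∤⇒coprime P p∤m (d∣p , d∣m) with prime⇒irreducible P d∣p
... | inj₁ d≡1 = d≡1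
... | inj₂ refl = contradiction d∣m p∤m

primes-coprime : ∀ {p p'} → Prime p → Prime p' → p ≢ p' → Coprime p p'
primes-coprime {p} P P' p≢p' = prime-∤⇒coprime P λ p∣p' → case prime⇒irreducible P' p∣p' of λ
  { (inj₁ p≡1) → nonTrivial⇒≢1 {{prime⇒nonTrivial P}} p≡1
  ; (inj₂ p≡p') → p≢p' p≡p' }

coprime-^ : ∀ {m n} → Coprime m n → ∀ k → Coprime (m ^ k) n
coprime-^ {n = n} m⊥n zero    = Coprimality.1-coprimeTo n
coprime-^         m⊥n (suc k) = coprime-* m⊥n (coprime-^ m⊥n k)

PrimePowerSplit : ℕ → ℕ → Set
PrimePowerSplit p m = Σ[ k ∈ ℕ ] Σ[ r ∈ ℕ ] m ≡ p ^ k * r × ¬ p ∣ r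

prime-power-split : ∀ {p} → Prime p → ∀ m → m ≢ 0 → PrimePowerSplit p m
prime-power-split {p} P = <-rec (λ m → m ≢ 0 → PrimePowerSplit p m) step
  where
  step : ∀ m → (∀ {m'} → m' < m → m' ≢ 0 → PrimePowerSplit p m') → m ≢ 0 → PrimePowerSplit p m
  step m rec m≢0 with p ∣? m
  ... | no p∤m = 0 , m , sym (*-identityˡ m) , p∤m
  ... | yes (divides m' refl) = one-more (rec (m<m*n m' p {{≢-nonZero m'≢0}} (prime>1 P)) m'≢0)
    where
    m'≢0 : m' ≢ 0
    m'≢0 refl = m≢0 refl
    one-more : PrimePowerSplit p m' → PrimePowerSplit p (m' * p)
    one-more (k , r , refl , p∤r) =
      suc k , r , solve 3 (λ x r p → x :* r :* p := p :* x :* r) refl (p ^ k) r p , p∤r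

-- A nonzero number with two distinct prime divisors p, p' is a product of two coprime
-- factors > 1: the p-power part and the rest, which still contains p'.
coprime-split : ∀ {n p p'} → n ≢ 0 → Prime p → Prime p' → p ∣ n → p' ∣ n → p ≢ p' →
  Σ[ q ∈ ℕ ] Σ[ r ∈ ℕ ] n ≡ q * r × Coprime q r × 1 < q × 1 < r
coprime-split {n} {p} {p'} n≢0 P P' p∣n p'∣n p≢p' with prime-power-split P n n≢0
... | k , r , refl , p∤r =
  p ^ k , r , refl , coprime-^ (prime-∤⇒coprime P p∤r) k , 1<p^k k p∣n , 1<r
  where
  1<p^k : ∀ j → p ∣ p ^ j * r → 1 < p ^ j
  1<p^k zero    p∣r = contradiction (subst (p ∣_) (*-identityˡ r) p∣r) p∤r
  1<p^k (suc j) _   = <-≤-trans (prime>1 P) (m≤m*n p (p ^ j) {{m^n≢0 p j {{prime⇒nonZero P}}}})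
  p'∣r : p' ∣ r
  p'∣r = coprime-divisor (Coprimality.sym (coprime-^ (primes-coprime P P' p≢p') k)) p'∣n
  r≢0 : r ≢ 0
  r≢0 refl = n≢0 (*-zeroʳ (p ^ k))
  1<r : 1 < r
  1<r = <-≤-trans (prime>1 P') (∣⇒≤ {{≢-nonZero r≢0}} p'∣r)

two-prime-divisors : ∀ n → 2 ≤ ω n →
  Σ[ p ∈ ℕ ] Σ[ p' ∈ ℕ ] Prime p × Prime p' × p ∣ n × p' ∣ n × p ≢ p'
two-prime-divisors n 2≤ω
  with two-witnesses (P ∘ suc) n (subst (2 ≤_) (length-filter-applyUpTo P suc n) 2≤ω)
  where
  P : ℕ → Bool
  P p = ⌊ prime? p ⌋ ∧ isDivisor p n
... | a , b , Pa , Pb , a≢b with ∧-elim {⌊ prime? (suc a) ⌋} Pa | ∧-elim {⌊ prime? (suc b) ⌋} Pb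
... | prime-a , a∣n | prime-b , b∣n =
  suc a , suc b , toWitness prime-a , toWitness prime-b , toWitness a∣n , toWitness b∣n ,
  a≢b ∘ suc-injective

-- The Klein four-group action on the bi-unitary divisors of a product of coprime q, r > 1:
-- writing d = a * b with a ∣ q and b ∣ r, flipQ replaces a by q / a and flipR replaces b by r / b.
module BiUnitaryKleinAction {q r : ℕ} (q⊥r : Coprime q r) (1<q : 1 < q) (1<r : 1 < r) where

  private
    q≢0 : q ≢ 0
    q≢0 = m<n⇒n≢0 1<q
    r≢0 : r ≢ 0
    r≢0 = m<n⇒n≢0 1<r
    n≢0 : q * r ≢ 0
    n≢0 = *-≢0 q≢0 r≢0

  open CoprimeFactorization q⊥r q≢0 r≢0

  isBU : ℕ → Bool
  isBU d = isBiUnitaryDivisor d (q * r)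

  -- d = a * b is recovered from a = gcd d q and b = gcd d r
  flipQ flipR : ℕ → ℕ
  flipQ d = cofactor q (gcd d q) * gcd d r
  flipR d = gcd d q * cofactor r (gcd d r)

  flipQ-* : ∀ {a b} → a ∣ q → b ∣ r → flipQ (a * b) ≡ cofactor q a * b
  flipQ-* a∣q b∣r =
    cong₂ (λ x y → cofactor q x * y) (gcd-coprime-part q⊥r a∣q b∣r) (gcd-r-part a∣q b∣r)

  flipR-* : ∀ {a b} → a ∣ q → b ∣ r → flipR (a * b) ≡ a * cofactor r b
  flipR-* a∣q b∣r =
    cong₂ (λ x y → x * cofactor r y) (gcd-coprime-part q⊥r a∣q b∣r) (gcd-r-part a∣q b∣r)

  flipQ-flipR-* : ∀ {a b} → a ∣ q → b ∣ r → flipQ (flipR (a * b)) ≡ cofactor q a * cofactor r b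
  flipQ-flipR-* a∣q b∣r = trans (cong flipQ (flipR-* a∣q b∣r)) (flipQ-* a∣q (cofactor-∣ b∣r))

  flipR-flipQ-* : ∀ {a b} → a ∣ q → b ∣ r → flipR (flipQ (a * b)) ≡ cofactor q a * cofactor r b
  flipR-flipQ-* a∣q b∣r = trans (cong flipR (flipQ-* a∣q b∣r)) (flipR-* (cofactor-∣ a∣q) b∣r)

  BiUnitaryParts : ℕ → Set
  BiUnitaryParts d = Σ[ a ∈ ℕ ] Σ[ b ∈ ℕ ] d ≡ a * b × BiUnitary a q × BiUnitary b r

  decompose : ∀ {d} → T (isBU d) → BiUnitaryParts d
  decompose {d} bu = split (factorize (proj₁ d-bu))
    where
    d-bu : BiUnitary d (q * r)
    d-bu = isBiUnitaryDivisor-sound n≢0 bu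
    split : Factorization d → BiUnitaryParts d
    split (a , b , a∣q , b∣r , d≡ab) =
      a , b , d≡ab , biunitary-split a∣q b∣r (subst (λ m → BiUnitary m (q * r)) d≡ab d-bu)

  compose : ∀ {a b} → BiUnitary a q → BiUnitary b r → T (isBU (a * b))
  compose A B = isBiUnitaryDivisor-complete n≢0 (biunitary-combine A B)

  by-parts : (P : ℕ → Set) → ∀ d → (∀ {a b} → BiUnitary a q → BiUnitary b r → P (a * b)) →
    T (isBU d) → P d
  by-parts P d on-parts bu = from-parts (decompose bu)
    where
    from-parts : BiUnitaryParts d → P d
    from-parts (a , b , d≡ab , A , B) = subst P (sym d≡ab) (on-parts A B)

  -- flipQ and flipR generate a free action of the Klein four-group: flipping twice restores a
  -- (resp. b), the flips act on different parts and so commute, and no non-identity element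
  -- fixes d because q / a ≠ a and r / b ≠ b.
  action : FreeKleinAction isBU flipQ flipR
  action = record
    { f-closed     = λ {d} → by-parts (λ d → T (isBU (flipQ d))) d λ A@(a∣q , _) B@(b∣r , _) →
        subst (T ∘ isBU) (sym (flipQ-* a∣q b∣r)) (compose (biunitary-complement q≢0 A) B)
    ; g-closed     = λ {d} → by-parts (λ d → T (isBU (flipR d))) d λ A@(a∣q , _) B@(b∣r , _) →
        subst (T ∘ isBU) (sym (flipR-* a∣q b∣r)) (compose A (biunitary-complement r≢0 B))
    ; f-involutive = λ {d} → by-parts (λ d → flipQ (flipQ d) ≡ d) d λ (a∣q , _) (b∣r , _) →
        flipQ-involutive a∣q b∣r
    ; g-involutive = λ {d} → by-parts (λ d → flipR (flipR d) ≡ d) d λ (a∣q , _) (b∣r , _) →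
        flipR-involutive a∣q b∣r
    ; commute      = λ {d} → by-parts (λ d → flipQ (flipR d) ≡ flipR (flipQ d)) d
        λ (a∣q , _) (b∣r , _) →
        trans (flipQ-flipR-* a∣q b∣r) (sym (flipR-flipQ-* a∣q b∣r))
    ; f-free       = λ {d} → by-parts (λ d → flipQ d ≢ d) d λ A@(a∣q , _) (b∣r , _) e →
        biunitary-complement-≢ 1<q A
          (proj₁ (factors-unique (cofactor-∣ a∣q) b∣r a∣q b∣r (trans (sym (flipQ-* a∣q b∣r)) e)))
    ; g-free       = λ {d} → by-parts (λ d → flipR d ≢ d) d λ (a∣q , _) B@(b∣r , _) e →
        biunitary-complement-≢ 1<r B
          (proj₂ (factors-unique a∣q (cofactor-∣ b∣r) a∣q b∣r (trans (sym (flipR-* a∣q b∣r)) e)))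
    ; fg-free      = λ {d} → by-parts (λ d → flipQ (flipR d) ≢ d) d λ A@(a∣q , _) (b∣r , _) e →
        biunitary-complement-≢ 1<q A
          (proj₁ (factors-unique (cofactor-∣ a∣q) (cofactor-∣ b∣r) a∣q b∣r
            (trans (sym (flipQ-flipR-* a∣q b∣r)) e)))
    }
    where
    open ≡-Reasoning
    flipQ-involutive : ∀ {a b} → a ∣ q → b ∣ r → flipQ (flipQ (a * b)) ≡ a * b
    flipQ-involutive {a} {b} a∣q b∣r = begin
      flipQ (flipQ (a * b))          ≡⟨ cong flipQ (flipQ-* a∣q b∣r) ⟩
      flipQ (cofactor q a * b)       ≡⟨ flipQ-* (cofactor-∣ a∣q) b∣r ⟩
      cofactor q (cofactor q a) * b  ≡⟨ cong (_* b) (cofactor-involutive q≢0 a∣q) ⟩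
      a * b                          ∎
    flipR-involutive : ∀ {a b} → a ∣ q → b ∣ r → flipR (flipR (a * b)) ≡ a * b
    flipR-involutive {a} {b} a∣q b∣r = begin
      flipR (flipR (a * b))          ≡⟨ cong flipR (flipR-* a∣q b∣r) ⟩
      flipR (a * cofactor r b)       ≡⟨ flipR-* a∣q (cofactor-∣ b∣r) ⟩
      a * cofactor r (cofactor r b)  ≡⟨ cong (a *_) (cofactor-involutive r≢0 b∣r) ⟩
      a * b                          ∎

  four-∣-d** : 4 ∣ d** (q * r)
  four-∣-d** = subst (4 ∣_) (sym (d**-count n≢0)) (four-∣-count action below)
    where
    below : ∀ {d} → T (isBU d) → d < suc (q * r)
    below bu = s≤s (∣⇒≤ {{≢-nonZero n≢0}} (proj₁ (isBiUnitaryDivisor-sound n≢0 bu)))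

harmonic-if-4∣d** : ∀ n → σ** n ≡ 4 * n → 4 ∣ d** n → BiUnitaryHarmonic n
harmonic-if-4∣d** n σ≡4n 4∣d =
  subst (_∣ n * d** n) (trans (*-comm n 4) (sym σ≡4n)) (*-monoʳ-∣ n 4∣d)

mainTheorem2 : (n : ℕ) → 0 < n → 2 ≤ ω n → σ** n ≡ 4 * n →
    BiUnitaryHarmonic n
mainTheorem2 n 0<n 2≤ω σ≡4n with two-prime-divisors n 2≤ω
... | p , p' , P , P' , p∣n , p'∣n , p≢p'
  with coprime-split (n>0⇒n≢0 0<n) P P' p∣n p'∣n p≢p'
... | q , r , refl , q⊥r , 1<q , 1<r =
  harmonic-if-4∣d** (q * r) σ≡4n (BiUnitaryKleinAction.four-∣-d** q⊥r 1<q 1<r)
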